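{- Let $\preceq$ be an admissible order on $\Lambda$, and let $\mathbf T(\preceq)$ be the set of all subsets $T\subseteq\Lambda$ such that for every quadruple $i<j<k<l$, the intersection of $T$ with the stick $(ijk,ijl,ikl,jkl)$ is an initial segment of the stick if $\preceq$ orients this stick directly, and a final segment of the stick if $\preceq$ orients it reversely. Then $\mathbf T(\preceq)$ is a Condorcet super-domain which is maximal by inclusion: there is no tiling $T\notin\mathbf T(\preceq)$ such that $\mathbf T(\preceq)\cup\{T\}$ is a Condorcet super-domain.
   Context: Fix an integer $n\ge 2$, $[n]=\{1,\dots,n\}$, and let $\Lambda$ be the set of triples $ijk$ with $i<j<k$ in $[n]$. For a quadruple $i<j<k<l$, its stick is the ordered sequence $(ijk,ijl,ikl,jkl)$; initial segments are $\emptyset,\{ijk\},\{ijk,ijl\},\{ijk,ijl,ikl\}$ and the whole stick, and final segments are defined symmetrically from the end. A subset of $\Lambda$ is a pseudo-tiling; it is a tiling if for every quadruple its intersection with the stick, written as a 0/1 string along the stick order, is one of $0000,1000,1100,1110,1111,0111,0011,0001$ (these are the inversion sets of rhombus tilings of the zonogon $Z(n;2)$). $\mathbf T$ denotes the set of tilings; a super-domain is a subset of $\mathbf T$. A (partial) order $\preceq$ on $\Lambda$ is admissible if its restriction to the four triples of each stick is either the lexicographic linear order $ijk\prec ijl\prec ikl\prec jkl$ (the stick is then said to be oriented directly) or its reverse (oriented reversely). Majority rule: for a finite set $V$ of odd cardinality and a family $(T_v)_{v\in V}$ of tilings (repetitions allowed), $sm((T_v)_{v\in V})=\{ijk\in\Lambda: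 |\{v: ijk\in T_v\}|>|V|/2\}$. A super-domain $\mathbf D$ is a Condorcet super-domain if for every finite odd-cardinality $V$ and every family $(T_v)_{v\in V}$ with all $T_v\in\mathbf D$, $sm((T_v)_{v\in V})$ is a tiling. -}

module Defs where

open import Level using (Level)
open import Data.Bool using (Bool; true; false; if_then_else_)
open import Data.Nat as ℕ using (ℕ; zero; suc; _+_; _*_; _<ᵇ_)
open import Data.Fin using (Fin; _<_; _≤_)
open import Data.Fin.Properties using (<-trans)
open import Data.Vec using (Vec; []; _∷_; lookup)
open import Data.List using (List; []; _∷_)
open import Data.List.Membership.Propositional using (_∈_)
open import Data.Product using (Σ; _×_)
open import Data.Sum using (_⊎_)
open import Relation.Binary.Core using (Rel)
open import Relation.Binary.Structures using (IsPartialOrder)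
open import Relation.Binary.PropositionalEquality using (_≡_)
open import Function.Bundles using (_⇔_)

-- [n] is modelled by Fin n (elements 0..n-1).
-- Λ : triples i<j<k.
record Triple (n : ℕ) : Set where
  constructor triple
  field
    i j k : Fin n
    i<j : i < j
    j<k : j < k

record Quad (n : ℕ) : Set where
  constructor quad
  field
    i j k l : Fin n
    i<j : i < j
    j<k : j < k
    k<l : k < l

stick : ∀ {n} → Quad n → Vec (Triple n) 4
stick (quad i j k l i<j j<k k<l) =
  triple i j k i<j j<k ∷
  triple i j l i<j (<-trans j<k k<l) ∷
  triple i k l (<-trans i<j j<k) k<l ∷
  triple j k l j<k k<l ∷ []

-- pseudo-tilings: subsets of Λ, given by their indicator function
PseudoTiling : ℕ → Set
PseudoTiling n = Triple n → Bool

SuperDomain : ℕ → Set₁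
SuperDomain n = PseudoTiling n → Set

stickString : ∀ {n} → PseudoTiling n → Quad n → Vec Bool 4
stickString T q = Data.Vec.map T (stick q)

private
  0' 1' : Bool
  0' = false
  1' = true

tilingStrings : List (Vec Bool 4)
tilingStrings =
  (0' ∷ 0' ∷ 0' ∷ 0' ∷ []) ∷ (1' ∷ 0' ∷ 0' ∷ 0' ∷ []) ∷
  (1' ∷ 1' ∷ 0' ∷ 0' ∷ []) ∷ (1' ∷ 1' ∷ 1' ∷ 0' ∷ []) ∷
  (1' ∷ 1' ∷ 1' ∷ 1' ∷ []) ∷ (0' ∷ 1' ∷ 1' ∷ 1' ∷ []) ∷
  (0' ∷ 0' ∷ 1' ∷ 1' ∷ []) ∷ (0' ∷ 0' ∷ 0' ∷ 1' ∷ []) ∷ []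

initialStrings : List (Vec Bool 4)
initialStrings =
  (0' ∷ 0' ∷ 0' ∷ 0' ∷ []) ∷ (1' ∷ 0' ∷ 0' ∷ 0' ∷ []) ∷
  (1' ∷ 1' ∷ 0' ∷ 0' ∷ []) ∷ (1' ∷ 1' ∷ 1' ∷ 0' ∷ []) ∷
  (1' ∷ 1' ∷ 1' ∷ 1' ∷ []) ∷ []

finalStrings : List (Vec Bool 4)
finalStrings =
  (0' ∷ 0' ∷ 0' ∷ 0' ∷ []) ∷ (0' ∷ 0' ∷ 0' ∷ 1' ∷ []) ∷
  (0' ∷ 0' ∷ 1' ∷ 1' ∷ []) ∷ (0' ∷ 1' ∷ 1' ∷ 1' ∷ []) ∷
  (1' ∷ 1' ∷ 1' ∷ 1' ∷ []) ∷ []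

IsTiling : ∀ {n} → PseudoTiling n → Set
IsTiling T = ∀ q → stickString T q ∈ tilingStrings

IsSuperDomain : ∀ {n} → SuperDomain n → Set
IsSuperDomain D = ∀ S → D S → IsTiling S

countTrue : (m : ℕ) → (Fin m → Bool) → ℕ
countTrue zero    b = zero
countTrue (suc m) b = (if b Data.Fin.zero then 1 else 0) + countTrue m (λ v → b (Data.Fin.suc v))

Odd : ℕ → Set
Odd m = Σ ℕ (λ k → m ≡ suc (2 * k))

-- majority rule sm for a family indexed by V = Fin m:
-- ijk ∈ sm iff |{v : ijk ∈ T_v}| > |V|/2, i.e. |V| < 2·|{v : ijk ∈ T_v}|
sm : ∀ {n} (m : ℕ) → (Fin m → PseudoTiling n) → PseudoTiling n
sm m Tv t = m <ᵇ 2 * countTrue m (λ v → Tv v t)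

-- Condorcet property (finite V of odd cardinality modelled as Fin m)
Condorcet : ∀ {n} → SuperDomain n → Set
Condorcet {n} D = (m : ℕ) → Odd m → (Tv : Fin m → PseudoTiling n) →
  (∀ v → D (Tv v)) → IsTiling (sm m Tv)

IsCondorcetSuperDomain : ∀ {n} → SuperDomain n → Set
IsCondorcetSuperDomain D = IsSuperDomain D × Condorcet D

-- D ∪ {T}  (membership in {T} is equality of subsets of Λ)
_∪｛_｝ : ∀ {n} → SuperDomain n → PseudoTiling n → SuperDomain n
(D ∪｛ T ｝) S = D S ⊎ (∀ t → S t ≡ T t)

-- orientation of sticks by an order ≼ on Λ:
-- the restriction of ≼ to the stick is the lexicographic linear order (or its reverse)
module _ {n : ℕ} (_≼_ : Rel (Triple n) Level.zero) where

  OrientsDirectly : Quad n → Set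
  OrientsDirectly q = (p r : Fin 4) →
    (lookup (stick q) p ≼ lookup (stick q) r) ⇔ (p ≤ r)

  OrientsReversely : Quad n → Set
  OrientsReversely q = (p r : Fin 4) →
    (lookup (stick q) p ≼ lookup (stick q) r) ⇔ (r ≤ p)

  Admissible : Set
  Admissible = IsPartialOrder _≡_ _≼_ × (∀ q → OrientsDirectly q ⊎ OrientsReversely q)

  TDomain : SuperDomain n
  TDomain T = ∀ q →
    (OrientsDirectly q → stickString T q ∈ initialStrings) ×
    (OrientsReversely q → stickString T q ∈ finalStrings)

-- On a directly oriented stick, lying in T(≼) means that the 0/1 string is descending, a
-- conjunction of inequalities between Booleans (dually ascending on a reversed stick). The
-- majority rule is monotone in each voter, so it preserves these inequalities and T(≼) is a
-- Condorcet domain. For maximality, let the tiling T violate the condition on a stick. Each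
-- initial (resp. final) segment of that stick is cut out by a member of T(≼): the empty set, or a
-- down-set {y : y ≼ x} of a triple x on the stick. For a suitable pair of them, the majority of
-- T and the pair is not a tiling string on that stick.

module Submission where

open import Defs
open import Level using (0ℓ)
open import Data.Bool using (Bool; true; false; T; _∨_; _∧_; if_then_else_; f≤t; b≤b)
  renaming (_≤_ to _≤ᵇ_)
open import Data.Bool.Properties using (≤-minimum) renaming (_≟_ to _≟ᵇ_)
open import Data.Empty using (⊥-elim)
open import Data.Unit using (tt)
open import Data.Nat using (ℕ; zero; suc; _≤_; _<ᵇ_; _*_; z≤n; s≤s)
open import Data.Nat.Properties
  using (+-mono-≤; ≤-refl; *-monoʳ-≤; <-≤-trans; <ᵇ⇒<; <⇒<ᵇ)
import Data.Fin as Fin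
open import Data.Fin using (Fin; #_) renaming (_≤?_ to _≤ᶠ?_; _<?_ to _<ᶠ?_)
open import Data.Fin.Properties using (sequence) renaming (<-irrelevant to <ᶠ-irrelevant)
open import Data.Vec using (Vec; []; _∷_; map; lookup; tabulate; _⊛_)
open import Data.Vec.Properties using (map-cong; tabulate-cong) renaming (≡-dec to ≡-decᵛ)
open import Data.List using (List)
open import Data.List.Relation.Unary.Any using (here; there)
open import Data.List.Relation.Unary.All using (All; all?)
  renaming (lookup to All-lookup; tabulate to All-tabulate)
open import Data.List.Membership.Propositional using (_∈_)
open import Data.List.Membership.DecPropositional (≡-decᵛ {n = 4} _≟ᵇ_) using (_∈?_)
open import Data.Product using (_×_; _,_; proj₁; proj₂; ∃-syntax)
open import Data.Sum using (_⊎_; inj₁; inj₂)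
open import Effect.Monad using (RawMonad)
open import Function using (_∘_; const)
open import Function.Bundles using (_⇔_; mk⇔; Equivalence)
open import Relation.Binary.Core using (Rel)
open import Relation.Binary.Definitions using (Decidable; Transitive)
open import Relation.Binary.Structures using (IsPartialOrder)
open import Relation.Binary.PropositionalEquality
  using (_≡_; refl; sym; subst; trans; cong; module ≡-Reasoning)
open import Relation.Nullary using (¬_; Dec; yes; no; does; Irrelevant)
open import Relation.Nullary.Decidable using
  (isYes; isYes≗does; toWitness; fromWitness; from-yes; does-⇔; _→-dec_; ¬¬-excluded-middle)
open import Relation.Nullary.Negation using (¬¬-Monad; ¬¬-map)

private
  variable
    n m : ℕ

T-mono⇒≤ : ∀ {a b} → (T a → T b) → a ≤ᵇ b
T-mono⇒≤ {false}         _ = ≤-minimum _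
T-mono⇒≤ {true}  {true}  _ = b≤b
T-mono⇒≤ {true}  {false} h = ⊥-elim (h tt)

indicator-mono : ∀ {a b} → a ≤ᵇ b → (if a then 1 else 0) ≤ (if b then 1 else 0)
indicator-mono f≤t = z≤n
indicator-mono b≤b = ≤-refl

countTrue-mono : ∀ m {b b′ : Fin m → Bool} → (∀ v → b v ≤ᵇ b′ v) →
  countTrue m b ≤ countTrue m b′
countTrue-mono zero    _ = z≤n
countTrue-mono (suc m) h = +-mono-≤ (indicator-mono (h Fin.zero)) (countTrue-mono m (h ∘ Fin.suc))

sm-mono : ∀ (Tv : Fin m → PseudoTiling n) {t t′} →
  (∀ v → Tv v t ≤ᵇ Tv v t′) → sm m Tv t ≤ᵇ sm m Tv t′
sm-mono {m} Tv h = T-mono⇒≤ λ t∈sm →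
  <⇒<ᵇ (<-≤-trans (<ᵇ⇒< m _ t∈sm) (*-monoʳ-≤ 2 (countTrue-mono m h)))

maj : Bool → Bool → Bool → Bool
maj a b c = if a then b ∨ c else b ∧ c

majᵛ : ∀ {k} → Vec Bool k → Vec Bool k → Vec Bool k → Vec Bool k
majᵛ u v w = map maj u ⊛ v ⊛ w

sm-three : ∀ (Tv : Fin 3 → PseudoTiling n) t →
  sm 3 Tv t ≡ maj (Tv (# 0) t) (Tv (# 1) t) (Tv (# 2) t)
sm-three Tv t with Tv (# 0) t | Tv (# 1) t | Tv (# 2) t
... | false | false | false = refl
... | false | false | true  = refl
... | false | true  | false = refl
... | false | true  | true  = refl
... | true  | false | false = refl
... | true  | false | true  = refl
... | true  | true  | false = refl
... | true  | true  | true  = refl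

map-maj : ∀ {A : Set} {k} (f g h : A → Bool) (xs : Vec A k) →
  map (λ x → maj (f x) (g x) (h x)) xs ≡ majᵛ (map f xs) (map g xs) (map h xs)
map-maj f g h []       = refl
map-maj f g h (x ∷ xs) = cong (_ ∷_) (map-maj f g h xs)

stickString-sm-three : ∀ (A B C : PseudoTiling n) q →
  stickString (sm 3 (lookup (A ∷ B ∷ C ∷ []))) q ≡
    majᵛ (stickString A q) (stickString B q) (stickString C q)
stickString-sm-three A B C q =
  trans (map-cong (sm-three (lookup (A ∷ B ∷ C ∷ []))) (stick q)) (map-maj A B C (stick q))

Descending Ascending : Vec Bool 4 → Set
Descending (a ∷ b ∷ c ∷ d ∷ []) = b ≤ᵇ a × c ≤ᵇ b × d ≤ᵇ c
Ascending  (a ∷ b ∷ c ∷ d ∷ []) = a ≤ᵇ b × b ≤ᵇ c × c ≤ᵇ d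

initial⇔descending : ∀ {s} → s ∈ initialStrings ⇔ Descending s
initial⇔descending = mk⇔ to from
  where
  to : ∀ {s} → s ∈ initialStrings → Descending s
  to (here refl)                         = b≤b , b≤b , b≤b
  to (there (here refl))                 = f≤t , b≤b , b≤b
  to (there (there (here refl)))         = b≤b , f≤t , b≤b
  to (there (there (there (here refl)))) = b≤b , b≤b , f≤t
  to (there (there (there (there (here refl))))) = b≤b , b≤b , b≤b

  from : ∀ {s} → Descending s → s ∈ initialStrings
  from {false ∷ false ∷ false ∷ false ∷ []} _ = here refl
  from {true  ∷ false ∷ false ∷ false ∷ []} _ = there (here refl)
  from {true  ∷ true  ∷ false ∷ false ∷ []} _ = there (there (here refl))
  from {true  ∷ true  ∷ true  ∷ false ∷ []} _ = there (there (there (here refl)))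
  from {true  ∷ true  ∷ true  ∷ true  ∷ []} _ = there (there (there (there (here refl))))
  from {false ∷ true  ∷ _     ∷ _     ∷ []} (() , _)
  from {_     ∷ false ∷ true  ∷ _     ∷ []} (_ , () , _)
  from {_     ∷ _     ∷ false ∷ true  ∷ []} (_ , _ , ())

final⇔ascending : ∀ {s} → s ∈ finalStrings ⇔ Ascending s
final⇔ascending = mk⇔ to from
  where
  to : ∀ {s} → s ∈ finalStrings → Ascending s
  to (here refl)                         = b≤b , b≤b , b≤b
  to (there (here refl))                 = b≤b , b≤b , f≤t
  to (there (there (here refl)))         = b≤b , f≤t , b≤b
  to (there (there (there (here refl)))) = f≤t , b≤b , b≤b
  to (there (there (there (there (here refl))))) = b≤b , b≤b , b≤b

  from : ∀ {s} → Ascending s → s ∈ finalStrings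
  from {false ∷ false ∷ false ∷ false ∷ []} _ = here refl
  from {false ∷ false ∷ false ∷ true  ∷ []} _ = there (here refl)
  from {false ∷ false ∷ true  ∷ true  ∷ []} _ = there (there (here refl))
  from {false ∷ true  ∷ true  ∷ true  ∷ []} _ = there (there (there (here refl)))
  from {true  ∷ true  ∷ true  ∷ true  ∷ []} _ = there (there (there (there (here refl))))
  from {true  ∷ false ∷ _     ∷ _     ∷ []} (() , _)
  from {_     ∷ true  ∷ false ∷ _     ∷ []} (_ , () , _)
  from {_     ∷ _     ∷ true  ∷ false ∷ []} (_ , _ , ())

sm-descending : ∀ (Tv : Fin m → PseudoTiling n) q →
  (∀ v → Descending (stickString (Tv v) q)) → Descending (stickString (sm m Tv) q)
sm-descending Tv q h =
  sm-mono Tv (proj₁ ∘ h) , sm-mono Tv (proj₁ ∘ proj₂ ∘ h) , sm-mono Tv (proj₂ ∘ proj₂ ∘ h)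

sm-ascending : ∀ (Tv : Fin m → PseudoTiling n) q →
  (∀ v → Ascending (stickString (Tv v) q)) → Ascending (stickString (sm m Tv) q)
sm-ascending Tv q h =
  sm-mono Tv (proj₁ ∘ h) , sm-mono Tv (proj₁ ∘ proj₂ ∘ h) , sm-mono Tv (proj₂ ∘ proj₂ ∘ h)

initial⊆tiling : ∀ {s} → s ∈ initialStrings → s ∈ tilingStrings
initial⊆tiling = All-lookup (from-yes (all? (_∈? tilingStrings) initialStrings))

final⊆tiling : ∀ {s} → s ∈ finalStrings → s ∈ tilingStrings
final⊆tiling = All-lookup (from-yes (all? (_∈? tilingStrings) finalStrings))

MajorityClosed : List (Vec Bool 4) → Vec Bool 4 → Set
MajorityClosed L s = All (λ a → All (λ b → majᵛ s a b ∈ tilingStrings) L) L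

majorityClosed? : ∀ L s → Dec (MajorityClosed L s)
majorityClosed? L s = all? (λ a → all? (λ b → majᵛ s a b ∈? tilingStrings) L) L

-- The non-initial tiling strings fail with these pairs of initial
-- strings: 0111 with 1100, 0000 gives 0100; 0011 with 1110, 1000 gives 1010; 0001 with 1111,
-- 1000 gives 1001. The final side is the mirror image.
majorityClosed⇒initial : ∀ {s} → s ∈ tilingStrings → MajorityClosed initialStrings s →
  s ∈ initialStrings
majorityClosed⇒initial = All-lookup (from-yes (all? (λ s →
  majorityClosed? initialStrings s →-dec s ∈? initialStrings) tilingStrings))

majorityClosed⇒final : ∀ {s} → s ∈ tilingStrings → MajorityClosed finalStrings s →
  s ∈ finalStrings
majorityClosed⇒final = All-lookup (from-yes (all? (λ s →
  majorityClosed? finalStrings s →-dec s ∈? finalStrings) tilingStrings))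

module _ {n} (_≼_ : Rel (Triple n) 0ℓ) where

  TDomain-tiling : (∀ q → OrientsDirectly _≼_ q ⊎ OrientsReversely _≼_ q) →
    IsSuperDomain (TDomain _≼_)
  TDomain-tiling oriented S S∈D q with oriented q
  ... | inj₁ direct  = initial⊆tiling (proj₁ (S∈D q) direct)
  ... | inj₂ reverse = final⊆tiling (proj₂ (S∈D q) reverse)

  sm-∈-TDomain : ∀ m (Tv : Fin m → PseudoTiling n) → (∀ v → TDomain _≼_ (Tv v)) →
    TDomain _≼_ (sm m Tv)
  sm-∈-TDomain m Tv h q =
    (λ direct → Equivalence.from initial⇔descending
      (sm-descending Tv q λ v → Equivalence.to initial⇔descending (proj₁ (h v q) direct))) ,
    (λ reverse → Equivalence.from final⇔ascending
      (sm-ascending Tv q λ v → Equivalence.to final⇔ascending (proj₂ (h v q) reverse)))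

  TDomain-condorcet : Admissible _≼_ → IsCondorcetSuperDomain (TDomain _≼_)
  TDomain-condorcet (_ , oriented) =
    TDomain-tiling oriented , λ m _ Tv h → TDomain-tiling oriented _ (sm-∈-TDomain m Tv h)

  ∅-∈-TDomain : TDomain _≼_ (const false)
  ∅-∈-TDomain q = (λ _ → here refl) , (λ _ → here refl)

  Realisable : Quad n → Vec Bool 4 → Set
  Realisable q s = ∃[ A ] TDomain _≼_ A × stickString A q ≡ s

  module _ {T : PseudoTiling n} (condorcet : Condorcet (TDomain _≼_ ∪｛ T ｝)) where

    majority-realisable : ∀ q {a b} → Realisable q a → Realisable q b →
      majᵛ (stickString T q) a b ∈ tilingStrings
    majority-realisable q (A , A∈D , refl) (B , B∈D , refl) =
      subst (_∈ tilingStrings) (stickString-sm-three T A B q)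
        (condorcet 3 (1 , refl) (lookup (T ∷ A ∷ B ∷ [])) voters q)
      where
      voters : ∀ v → (TDomain _≼_ ∪｛ T ｝) (lookup (T ∷ A ∷ B ∷ []) v)
      voters Fin.zero                     = inj₂ λ _ → refl
      voters (Fin.suc Fin.zero)           = inj₁ A∈D
      voters (Fin.suc (Fin.suc Fin.zero)) = inj₁ B∈D

    majorityClosed : ∀ L q → (∀ {a} → a ∈ L → Realisable q a) →
      MajorityClosed L (stickString T q)
    majorityClosed L q realise = All-tabulate λ a∈L → All-tabulate λ b∈L →
      majority-realisable q (realise a∈L) (realise b∈L)

isYes-⇔ : ∀ {A B : Set} → A ⇔ B → (a? : Dec A) (b? : Dec B) → isYes a? ≡ isYes b?
isYes-⇔ A⇔B a? b? = begin
  isYes a? ≡⟨ isYes≗does a? ⟩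
  does a?  ≡⟨ does-⇔ A⇔B a? b? ⟩
  does b?  ≡⟨ sym (isYes≗does b?) ⟩
  isYes b? ∎
  where open ≡-Reasoning

module DownSets {n} (_≼_ : Rel (Triple n) 0ℓ)
  (≼-trans : Transitive _≼_) (_≼?_ : Decidable _≼_) where

  ↓_ : Triple n → PseudoTiling n
  (↓ x) y = isYes (y ≼? x)

  ↓-antitone : ∀ {x y z} → y ≼ z → (↓ x) z ≤ᵇ (↓ x) y
  ↓-antitone y≼z = T-mono⇒≤ λ z≼x → fromWitness (≼-trans y≼z (toWitness z≼x))

  ↓-∈-TDomain : ∀ x → TDomain _≼_ (↓ x)
  ↓-∈-TDomain x q =
    (λ direct → Equivalence.from initial⇔descending
      ( ↓-antitone (Equivalence.from (direct (# 0) (# 1)) z≤n)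
      , ↓-antitone (Equivalence.from (direct (# 1) (# 2)) (s≤s z≤n))
      , ↓-antitone (Equivalence.from (direct (# 2) (# 3)) (s≤s (s≤s z≤n))))) ,
    (λ reverse → Equivalence.from final⇔ascending
      ( ↓-antitone (Equivalence.from (reverse (# 1) (# 0)) z≤n)
      , ↓-antitone (Equivalence.from (reverse (# 2) (# 1)) (s≤s z≤n))
      , ↓-antitone (Equivalence.from (reverse (# 3) (# 2)) (s≤s (s≤s z≤n)))))

  stickString-↓-direct : ∀ {q} → OrientsDirectly _≼_ q → ∀ r →
    stickString (↓ lookup (stick q) r) q ≡ tabulate (λ p → isYes (p ≤ᶠ? r))
  stickString-↓-direct direct r =
    tabulate-cong λ p → isYes-⇔ (direct p r) (_ ≼? _) (p ≤ᶠ? r)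

  stickString-↓-reverse : ∀ {q} → OrientsReversely _≼_ q → ∀ r →
    stickString (↓ lookup (stick q) r) q ≡ tabulate (λ p → isYes (r ≤ᶠ? p))
  stickString-↓-reverse reverse r =
    tabulate-cong λ p → isYes-⇔ (reverse p r) (_ ≼? _) (r ≤ᶠ? p)

  initial-realisable : ∀ {q s} → OrientsDirectly _≼_ q → s ∈ initialStrings →
    Realisable _≼_ q s
  initial-realisable direct (here refl) = const false , ∅-∈-TDomain _≼_ , refl
  initial-realisable direct (there (here refl)) =
    _ , ↓-∈-TDomain _ , stickString-↓-direct direct (# 0)
  initial-realisable direct (there (there (here refl))) =
    _ , ↓-∈-TDomain _ , stickString-↓-direct direct (# 1)
  initial-realisable direct (there (there (there (here refl)))) =
    _ , ↓-∈-TDomain _ , stickString-↓-direct direct (# 2)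
  initial-realisable direct (there (there (there (there (here refl))))) =
    _ , ↓-∈-TDomain _ , stickString-↓-direct direct (# 3)

  final-realisable : ∀ {q s} → OrientsReversely _≼_ q → s ∈ finalStrings →
    Realisable _≼_ q s
  final-realisable reverse (here refl) = const false , ∅-∈-TDomain _≼_ , refl
  final-realisable reverse (there (here refl)) =
    _ , ↓-∈-TDomain _ , stickString-↓-reverse reverse (# 3)
  final-realisable reverse (there (there (here refl))) =
    _ , ↓-∈-TDomain _ , stickString-↓-reverse reverse (# 2)
  final-realisable reverse (there (there (there (here refl)))) =
    _ , ↓-∈-TDomain _ , stickString-↓-reverse reverse (# 1)
  final-realisable reverse (there (there (there (there (here refl))))) =
    _ , ↓-∈-TDomain _ , stickString-↓-reverse reverse (# 0)

  condorcet-extension⇒∈TDomain : ∀ {T} → IsTiling T → Condorcet (TDomain _≼_ ∪｛ T ｝) →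
    TDomain _≼_ T
  condorcet-extension⇒∈TDomain tiling condorcet q =
    (λ direct → majorityClosed⇒initial (tiling q)
      (majorityClosed _≼_ condorcet initialStrings q (initial-realisable direct))) ,
    (λ reverse → majorityClosed⇒final (tiling q)
      (majorityClosed _≼_ condorcet finalStrings q (final-realisable reverse)))

¬¬-∀-Fin : ∀ {P : Fin m → Set} → (∀ i → ¬ ¬ P i) → ¬ ¬ (∀ i → P i)
¬¬-∀-Fin = sequence (RawMonad.rawApplicative ¬¬-Monad)

¬¬-∀-irrelevant : ∀ {A : Set} {P : A → Set} → Dec A → Irrelevant A →
  (∀ a → ¬ ¬ P a) → ¬ ¬ (∀ a → P a)
¬¬-∀-irrelevant {P = P} (yes a) irrelevant h =
  ¬¬-map (λ Pa a′ → subst P (irrelevant a a′) Pa) (h a)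
¬¬-∀-irrelevant         (no ¬a) _          _ = λ k → k λ a → ⊥-elim (¬a a)

¬¬-∀-Triple : ∀ {P : Triple n → Set} → (∀ x → ¬ ¬ P x) → ¬ ¬ (∀ x → P x)
¬¬-∀-Triple h = ¬¬-map (λ f (triple i j k i<j j<k) → f i j k i<j j<k)
  (¬¬-∀-Fin λ i → ¬¬-∀-Fin λ j → ¬¬-∀-Fin λ k →
    ¬¬-∀-irrelevant (i <ᶠ? j) <ᶠ-irrelevant λ i<j →
    ¬¬-∀-irrelevant (j <ᶠ? k) <ᶠ-irrelevant λ j<k → h (triple i j k i<j j<k))

-- Down-sets of ≼ can only be formed once ≼ is decided; finiteness of Λ makes that decision
-- available under double negation, which is enough to refute the extended domain.
¬¬-decidable : (R : Rel (Triple n) 0ℓ) → ¬ ¬ Decidable R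
¬¬-decidable R = ¬¬-∀-Triple λ x → ¬¬-∀-Triple λ y → ¬¬-excluded-middle

theorem2 : (n : ℕ) → 2 ≤ n → (_≼_ : Rel (Triple n) 0ℓ) → Admissible _≼_ →
    IsCondorcetSuperDomain (TDomain _≼_) ×
    ((T : PseudoTiling n) → IsTiling T → ¬ TDomain _≼_ T →
      ¬ IsCondorcetSuperDomain (TDomain _≼_ ∪｛ T ｝))
theorem2 _ _ _≼_ admissible@(partialOrder , _) =
  TDomain-condorcet _≼_ admissible ,
  λ T tiling T∉D (_ , condorcet) → ¬¬-decidable _≼_ λ _≼?_ →
    T∉D (condorcet-extension⇒∈TDomain (IsPartialOrder.trans partialOrder) _≼?_ tiling condorcet)
  where open DownSets _≼_
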